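{- Let $\mathfrak{M}=(\mathbf{M},\models,\mathcal{P}(\mathscr{L}))$ be a normal abstract model structure, $\tau_N$ the topology on $\mathbf{M}$ generated by the subbase $\{\mathbf{M}\setminus\mathsf{Mod}(\{\alpha\})\mid\alpha\in\mathscr{L}\}$, and $\tau_C$ the topology on $\mathbf{M}$ generated by the base $\{\mathsf{Mod}(\Gamma)\mid\Gamma\subseteq\mathscr{L}\}$. Let $(m_i)_{i\in I}$ be a family in $\mathbf{M}$, $\mathcal{U}$ an ultrafilter on $I$ and $\mathsf{u}\in\mathbf{M}$. Then $\mathsf{u}$ is a $\mathcal{U}$-ultralimit of $(m_i)_{i\in I}$ in both $(\mathbf{M},\tau_N)$ and $(\mathbf{M},\tau_C)$ iff for all $\Sigma\subseteq\mathscr{L}$: $\mathsf{u}\models\Sigma$ iff $\{i\in I\mid m_i\models\Sigma\}\in\mathcal{U}$.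
   Context: An abstract model structure is a triple $(\mathbf{M},\models,\mathcal{P}(\mathscr{L}))$ with $\mathbf{M}\neq\emptyset$, $\mathscr{L}$ a set and $\models\,\subseteq\mathbf{M}\times\mathcal{P}(\mathscr{L})$. It is normal if for all $m$ and $\Gamma$: $m\models\Gamma$ iff $m\models\{\alpha\}$ for all $\alpha\in\Gamma$. $\mathsf{Mod}(\Gamma)=\{m\in\mathbf{M}\mid m\models\Gamma\}$. For a topological space $(X,\tau)$, a family $(x_i)_{i\in I}$ and an ultrafilter $\mathcal{U}$ on $I$, $x\in X$ is a $\mathcal{U}$-ultralimit of $(x_i)$ if for every $\tau$-open $U\ni x$, $\{i\in I\mid x_i\in U\}\in\mathcal{U}$. -}

module Defs where

open import Level using (0ℓ; Level)
open import Data.Product using (Σ; _×_; _,_)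
open import Data.Sum using (_⊎_)
open import Data.Unit using (⊤)
open import Data.List using (List)
open import Data.List.Relation.Unary.All using (All)
open import Relation.Nullary using (¬_)
open import Relation.Unary using (Pred; _∈_; _⊆_; _∩_; ∁; ∅)
open import Relation.Binary.PropositionalEquality using (_≡_)
open import Function.Bundles using (_⇔_)

record AbstractModelStructure : Set₁ where
  field
    M     : Set
    L     : Set
    _⊨_   : M → Pred L 0ℓ → Set
    point : M               -- M ≠ ∅

｛_｝ : {L : Set} → L → Pred L 0ℓ
｛ α ｝ = λ β → β ≡ α

module _ (𝔐 : AbstractModelStructure) where
  open AbstractModelStructure 𝔐

  Normal : Set₁
  Normal = ∀ (m : M) (Γ : Pred L 0ℓ) → (m ⊨ Γ) ⇔ (∀ α → α ∈ Γ → m ⊨ ｛ α ｝)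

  Mod : Pred L 0ℓ → Pred M 0ℓ
  Mod Γ = λ m → m ⊨ Γ

-- Open sets of the topology on X generated by the subbase {S a | a ∈ A}:
-- unions of finite intersections of subbase elements, i.e. U is open iff
-- every point of U lies in some finite intersection of subbase elements
-- contained in U (the empty intersection being X).
SubbaseOpen : {X A : Set} → (A → Pred X 0ℓ) → Pred X 0ℓ → Set
SubbaseOpen {X} {A} S U =
  ∀ x → x ∈ U → Σ (List A) λ as →
    All (λ a → x ∈ S a) as × (∀ y → All (λ a → y ∈ S a) as → y ∈ U)

BaseOpen : {a : Level} {X : Set} {A : Set a} → (A → Pred X 0ℓ) → Pred X 0ℓ → Set a
BaseOpen {a} {X} {A} B U = ∀ x → x ∈ U → Σ A λ a → x ∈ B a × B a ⊆ U

-- ultrafilter on I (𝒰 is the membership predicate on subsets of I)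
record IsUltrafilter {I : Set} (𝒰 : Pred I 0ℓ → Set) : Set₁ where
  field
    whole  : 𝒰 (λ _ → ⊤)
    proper : ¬ 𝒰 ∅
    upward : ∀ {A B : Pred I 0ℓ} → A ⊆ B → 𝒰 A → 𝒰 B
    inter  : ∀ {A B : Pred I 0ℓ} → 𝒰 A → 𝒰 B → 𝒰 (A ∩ B)
    ultra  : ∀ (A : Pred I 0ℓ) → 𝒰 A ⊎ 𝒰 (∁ A)

IsUltralimit : {a : Level} {X I : Set} → (Pred X 0ℓ → Set a) → (Pred I 0ℓ → Set) →
               (I → X) → X → Set (Level.suc 0ℓ Level.⊔ a)
IsUltralimit {a} {X} {I} Open 𝒰 xs x =
  ∀ (U : Pred X 0ℓ) → Open U → x ∈ U → 𝒰 (λ i → xs i ∈ U)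

module _ (𝔐 : AbstractModelStructure) where
  open AbstractModelStructure 𝔐

  OpenN : Pred M 0ℓ → Set
  OpenN = SubbaseOpen (λ α → ∁ (Mod 𝔐 ｛ α ｝))

  OpenC : Pred M 0ℓ → Set₁
  OpenC = BaseOpen (Mod 𝔐)

-- Convergence in τ_C says exactly that every Γ satisfied by u is satisfied by 𝒰-almost
-- all m i, since the sets Mod Γ form a base.  Convergence in τ_N says that 𝒰-almost all
-- m i fail every α that u fails; as 𝒰 is an ultrafilter, and classically, this is the
-- converse for single sentences: 𝒰-almost all m i ⊨ {α} implies u ⊨ {α}.  Normality
-- lifts this converse from singletons to arbitrary Σ.
module Submission where

open import Defs
open import Level using (0ℓ; Level)
open import Data.Product using (_×_; _,_)
open import Data.Sum using (inj₁; inj₂)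
open import Data.Empty using (⊥-elim)
open import Data.List using (List; []; _∷_)
open import Data.List.Relation.Unary.All as All using (All; []; _∷_)
open import Relation.Unary using (Pred; _∈_; ∁)
open import Relation.Nullary using (¬_)
open import Relation.Nullary.Decidable using (decidable-stable)
open import Function using (id)
open import Function.Bundles using (_⇔_; mk⇔; Equivalence)
open import Axiom.ExcludedMiddle using (ExcludedMiddle)

open Equivalence using (to; from)

module UltrafilterProperties {I : Set} {𝒰 : Pred I 0ℓ → Set} (uf : IsUltrafilter 𝒰) where
  open IsUltrafilter uf

  ∁∈⇔∉ : (A : Pred I 0ℓ) → 𝒰 (∁ A) ⇔ (¬ 𝒰 A)
  ∁∈⇔∉ A = mk⇔ ∁∈⇒∉ ∉⇒∁∈
    where
    ∁∈⇒∉ : 𝒰 (∁ A) → ¬ 𝒰 A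
    ∁∈⇒∉ ∁A∈𝒰 A∈𝒰 = proper (upward (λ { (i∈A , i∉A) → i∉A i∈A }) (inter A∈𝒰 ∁A∈𝒰))

    ∉⇒∁∈ : ¬ 𝒰 A → 𝒰 (∁ A)
    ∉⇒∁∈ A∉𝒰 with ultra A
    ... | inj₁ A∈𝒰  = ⊥-elim (A∉𝒰 A∈𝒰)
    ... | inj₂ ∁A∈𝒰 = ∁A∈𝒰

  All∈ : {A : Set} {P : A → Pred I 0ℓ} (as : List A) →
         All (λ a → 𝒰 (P a)) as → 𝒰 (λ i → All (λ a → P a i) as)
  All∈ []       []            = upward (λ _ → []) whole
  All∈ (a ∷ as) (Pa∈𝒰 ∷ Ps∈𝒰) =
    upward (λ { (Pa , Ps) → Pa ∷ Ps }) (inter Pa∈𝒰 (All∈ as Ps∈𝒰))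

module UltralimitProperties {I : Set} {𝒰 : Pred I 0ℓ → Set} (uf : IsUltrafilter 𝒰)
                            {X : Set} (xs : I → X) (x : X) where
  open IsUltrafilter uf using (upward)
  open UltrafilterProperties uf using (All∈)

  ultralimit-base⇔ : {a : Level} {A : Set a} (B : A → Pred X 0ℓ) →
                     IsUltralimit (BaseOpen B) 𝒰 xs x ⇔
                     (∀ a → x ∈ B a → 𝒰 (λ i → xs i ∈ B a))
  ultralimit-base⇔ B = mk⇔ limit⇒ ⇒limit
    where
    limit⇒ : IsUltralimit (BaseOpen B) 𝒰 xs x → ∀ a → x ∈ B a → 𝒰 (λ i → xs i ∈ B a)
    limit⇒ lim a = lim (B a) (λ _ y∈Ba → a , y∈Ba , id)

    ⇒limit : (∀ a → x ∈ B a → 𝒰 (λ i → xs i ∈ B a)) → IsUltralimit (BaseOpen B) 𝒰 xs x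
    ⇒limit conv U U-open x∈U with U-open x x∈U
    ... | a , x∈Ba , Ba⊆U = upward Ba⊆U (conv a x∈Ba)

  ultralimit-subbase⇔ : {A : Set} (S : A → Pred X 0ℓ) →
                        IsUltralimit (SubbaseOpen S) 𝒰 xs x ⇔
                        (∀ a → x ∈ S a → 𝒰 (λ i → xs i ∈ S a))
  ultralimit-subbase⇔ S = mk⇔ limit⇒ ⇒limit
    where
    limit⇒ : IsUltralimit (SubbaseOpen S) 𝒰 xs x → ∀ a → x ∈ S a → 𝒰 (λ i → xs i ∈ S a)
    limit⇒ lim a = lim (S a) (λ _ y∈Sa → a ∷ [] , y∈Sa ∷ [] , λ { _ (z∈Sa ∷ []) → z∈Sa })

    ⇒limit : (∀ a → x ∈ S a → 𝒰 (λ i → xs i ∈ S a)) → IsUltralimit (SubbaseOpen S) 𝒰 xs x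
    ⇒limit conv U U-open x∈U with U-open x x∈U
    ... | as , x∈Sas , Sas⊆U = upward (Sas⊆U _) (All∈ as (All.map (conv _) x∈Sas))

module _ (𝔐 : AbstractModelStructure) where
  open AbstractModelStructure 𝔐

  module _ {I : Set} {𝒰 : Pred I 0ℓ → Set} (uf : IsUltrafilter 𝒰) (m : I → M) (u : M) where
    open UltrafilterProperties uf using (∁∈⇔∉)
    open UltralimitProperties uf m u

    ultralimitC⇔ : IsUltralimit (OpenC 𝔐) 𝒰 m u ⇔ (∀ Γ → u ⊨ Γ → 𝒰 (λ i → m i ⊨ Γ))
    ultralimitC⇔ = ultralimit-base⇔ (Mod 𝔐)

    ultralimitN⇔ : ExcludedMiddle 0ℓ →
                   IsUltralimit (OpenN 𝔐) 𝒰 m u ⇔ (∀ α → 𝒰 (λ i → m i ⊨ ｛ α ｝) → u ⊨ ｛ α ｝)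
    ultralimitN⇔ em = mk⇔ (λ lim → limit⇒ (to subbase⇔ lim)) (λ reflects → from subbase⇔ (⇒limit reflects))
      where
      subbase⇔ : IsUltralimit (OpenN 𝔐) 𝒰 m u ⇔
                 (∀ α → ¬ u ⊨ ｛ α ｝ → 𝒰 (λ i → ¬ m i ⊨ ｛ α ｝))
      subbase⇔ = ultralimit-subbase⇔ (λ α → ∁ (Mod 𝔐 ｛ α ｝))

      limit⇒ : (∀ α → ¬ u ⊨ ｛ α ｝ → 𝒰 (λ i → ¬ m i ⊨ ｛ α ｝)) →
               ∀ α → 𝒰 (λ i → m i ⊨ ｛ α ｝) → u ⊨ ｛ α ｝
      limit⇒ conv α α∈𝒰 = decidable-stable em (λ u⊭α → to (∁∈⇔∉ _) (conv α u⊭α) α∈𝒰)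

      ⇒limit : (∀ α → 𝒰 (λ i → m i ⊨ ｛ α ｝) → u ⊨ ｛ α ｝) →
               ∀ α → ¬ u ⊨ ｛ α ｝ → 𝒰 (λ i → ¬ m i ⊨ ｛ α ｝)
      ⇒limit reflects α u⊭α = from (∁∈⇔∉ _) (λ α∈𝒰 → u⊭α (reflects α α∈𝒰))

    Normal⇒reflects-⊨ : Normal 𝔐 → (∀ α → 𝒰 (λ i → m i ⊨ ｛ α ｝) → u ⊨ ｛ α ｝) →
                        ∀ Σ → 𝒰 (λ i → m i ⊨ Σ) → u ⊨ Σ
    Normal⇒reflects-⊨ normal reflects Σ Σ∈𝒰 =
      from (normal u Σ) (λ α α∈Σ →
        reflects α (upward (λ {i} mᵢ⊨Σ → to (normal (m i) Σ) mᵢ⊨Σ α α∈Σ) Σ∈𝒰))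
      where open IsUltrafilter uf using (upward)

theorem3p42 : ExcludedMiddle 0ℓ → (𝔐 : AbstractModelStructure) → Normal 𝔐 →
    {I : Set} (m : I → AbstractModelStructure.M 𝔐) (𝒰 : Pred I 0ℓ → Set) →
    IsUltrafilter 𝒰 → (u : AbstractModelStructure.M 𝔐) →
    (IsUltralimit (OpenN 𝔐) 𝒰 m u × IsUltralimit (OpenC 𝔐) 𝒰 m u)
      ⇔ (∀ (Σ : Pred (AbstractModelStructure.L 𝔐) 0ℓ) →
           AbstractModelStructure._⊨_ 𝔐 u Σ
             ⇔ 𝒰 (λ i → AbstractModelStructure._⊨_ 𝔐 (m i) Σ))
theorem3p42 em 𝔐 normal m 𝒰 uf u = mk⇔
  (λ (limN , limC) Σ →
     mk⇔ (to (ultralimitC⇔ 𝔐 uf m u) limC Σ)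
         (Normal⇒reflects-⊨ 𝔐 uf m u normal (to (ultralimitN⇔ 𝔐 uf m u em) limN) Σ))
  (λ ⊨⇔𝒰 → from (ultralimitN⇔ 𝔐 uf m u em) (λ α → from (⊨⇔𝒰 ｛ α ｝))
         , from (ultralimitC⇔ 𝔐 uf m u) (λ Γ → to (⊨⇔𝒰 Γ)))
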